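{- Let $p$ be a prime power. Consider the group $H$ of $3\times3$ matrices $\begin{bmatrix}1&\ell_1&Q\\0&1&\ell_2\\0&0&1\end{bmatrix}$ with $\ell_1,\ell_2\in\mathbb{F}_p[t]$ of degree at most $1$ and $Q\in\mathbb{F}_p[t]$ of degree at most $2$, and its subgroups $H_1=\{\begin{bmatrix}1&\ell&0\\0&1&0\\0&0&1\end{bmatrix}\}$ and $H_2=\{\begin{bmatrix}1&0&0\\0&1&\ell\\0&0&1\end{bmatrix}\}$ ($\ell$ ranging over polynomials of degree at most $1$). For such $\ell,Q$ put $M_1(\ell,Q)=\begin{bmatrix}1&0&Q\\0&1&\ell\\0&0&1\end{bmatrix}$ and $M_2(\ell,Q)=\begin{bmatrix}1&\ell&Q\\0&1&0\\0&0&1\end{bmatrix}$. Then for all $\ell_1,\ell_2\in\mathbb{F}_p[t]$ of degree at most $1$ and $Q_1,Q_2\in\mathbb{F}_p[t]$ of degree at most $2$, $$M_1(\ell_1,Q_1)H_1\cap M_2(\ell_2,Q_2)H_2\neq\emptyset \iff \ell_1\ell_2=Q_1-Q_2.$$ -}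

module Defs where

open import Level using (Level; _⊔_)
open import Algebra.Bundles using (CommutativeRing)
open import Data.Nat using (ℕ; zero; suc; _<_; _^_; _≤_; _∸_)
open import Data.Nat.Primality using (Prime)
open import Data.Fin using (Fin)
open import Data.Fin.Patterns using (0F; 1F; 2F)
open import Data.Product using (Σ; ∃; ∃-syntax; _×_; _,_)
open import Function.Bundles using (Bijection)
open import Relation.Nullary using (¬_)
import Relation.Binary.PropositionalEquality as ≡

IsPrimePower : ℕ → Set
IsPrimePower q = ∃[ r ] ∃[ k ] (Prime r × 1 ≤ k × q ≡.≡ r ^ k)

module _ {c ℓ : Level} (R : CommutativeRing c ℓ) where
  open CommutativeRing R using (Carrier; _≈_; _+_; _*_; _-_; 0#; 1#; setoid)

  IsField : Set (c ⊔ ℓ)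
  IsField = (¬ (1# ≈ 0#)) × (∀ x → ¬ (x ≈ 0#) → ∃[ y ] (x * y ≈ 1#))

  HasCard : ℕ → Set (c ⊔ ℓ)
  HasCard q = Bijection setoid (≡.setoid (Fin q))

  -- Polynomials over R in t, as coefficient sequences (coefficient of t^i);
  -- every Poly used below has bounded degree, so this is R[t].
  Poly : Set c
  Poly = ℕ → Carrier

  _≈ₚ_ : Poly → Poly → Set ℓ
  f ≈ₚ g = ∀ i → f i ≈ g i

  DegLe : Poly → ℕ → Set ℓ
  DegLe f d = ∀ i → d < i → f i ≈ 0#

  0ₚ : Poly
  0ₚ _ = 0#

  1ₚ : Poly
  1ₚ zero = 1#
  1ₚ (suc _) = 0#

  _+ₚ_ : Poly → Poly → Poly
  (f +ₚ g) i = f i + g i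

  _-ₚ_ : Poly → Poly → Poly
  (f -ₚ g) i = f i - g i

  convSum : (ℕ → ℕ → Carrier) → ℕ → ℕ → Carrier
  convSum h zero n = h zero n
  convSum h (suc m) n = h (suc m) (n ∸ suc m) + convSum h m n

  _*ₚ_ : Poly → Poly → Poly
  (f *ₚ g) n = convSum (λ i j → f i * g j) n n

  Mat : Set c
  Mat = Fin 3 → Fin 3 → Poly

  _≈ₘ_ : Mat → Mat → Set ℓ
  A ≈ₘ B = ∀ i j → A i j ≈ₚ B i j

  _·_ : Mat → Mat → Mat
  (A · B) i j = ((A i 0F *ₚ B 0F j) +ₚ (A i 1F *ₚ B 1F j)) +ₚ (A i 2F *ₚ B 2F j)

  heis : Poly → Poly → Poly → Mat
  heis a b c 0F 0F = 1ₚ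
  heis a b c 0F 1F = a
  heis a b c 0F 2F = b
  heis a b c 1F 0F = 0ₚ
  heis a b c 1F 1F = 1ₚ
  heis a b c 1F 2F = c
  heis a b c 2F 0F = 0ₚ
  heis a b c 2F 1F = 0ₚ
  heis a b c 2F 2F = 1ₚ

  M₁ : Poly → Poly → Mat
  M₁ l Q = heis 0ₚ Q l

  M₂ : Poly → Poly → Mat
  M₂ l Q = heis l Q 0ₚ

  InH₁ : Mat → Set (c ⊔ ℓ)
  InH₁ h = ∃[ l ] (DegLe l 1 × h ≈ₘ heis l 0ₚ 0ₚ)

  InH₂ : Mat → Set (c ⊔ ℓ)
  InH₂ h = ∃[ l ] (DegLe l 1 × h ≈ₘ heis 0ₚ 0ₚ l)

  CosetsMeet : Mat → Mat → Set (c ⊔ ℓ)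
  CosetsMeet A B = ∃[ h₁ ] ∃[ h₂ ] (InH₁ h₁ × InH₂ h₂ × (A · h₁) ≈ₘ (B · h₂))

-- Write ⟨a, b, c⟩ for the matrix [[1, a, b], [0, 1, c], [0, 0, 1]] over R[t].
-- The whole argument is the Heisenberg multiplication law
--     ⟨a, b, c⟩ · ⟨a', b', c'⟩ = ⟨a + a', (b + b') + a c', c + c'⟩,
-- which holds over any commutative ring R.  It turns the two cosets into
-- explicit parametrised families:
--     M₁(l₁, Q₁) · ⟨a, 0, 0⟩ = ⟨a, Q₁, l₁⟩,    M₂(l₂, Q₂) · ⟨0, 0, c⟩ = ⟨l₂, Q₂ + l₂ c, c⟩.
-- Comparing entries, the cosets meet iff c = l₁, a = l₂ and Q₁ = Q₂ + l₂ l₁ for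
-- some admissible a, c, i.e. iff Q₁ = Q₂ + l₂ l₁.  Since l₁, l₂ are linear,
-- l₂ l₁ = l₁ l₂, which gives the stated criterion l₁ l₂ = Q₁ - Q₂.
module Submission where

open import Defs
open import Level using (Level)
open import Algebra.Bundles using (CommutativeRing)
open import Data.Nat using (ℕ; zero; suc; _≤_; _<_; _∸_; z≤n; s≤s)
open import Data.Nat.Properties using (≤-refl; m≤n⇒m≤1+n; m<n⇒0<n∸m; n∸n≡0)
open import Data.Product using (_×_; _,_)
open import Data.Fin.Patterns using (0F; 1F; 2F)
import Algebra.Properties.Group as GroupProperties
import Algebra.Properties.Quasigroup as QuasigroupProperties

module HeisenbergCosets {c ℓ : Level} (F : CommutativeRing c ℓ) where
  open CommutativeRing F hiding (zero)
  open GroupProperties +-group using (quasigroup; //-rightDividesˡ)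
  open QuasigroupProperties quasigroup using (x≈z//y)
  open import Relation.Binary.Reasoning.Setoid setoid

  infix  4 _≋_ _≋ₘ_
  infixl 6 _⊕_
  infixl 7 _⊛_

  _≋_ : Poly F → Poly F → Set ℓ
  _≋_ = _≈ₚ_ F

  _⊕_ _⊛_ : Poly F → Poly F → Poly F
  _⊕_ = _+ₚ_ F
  _⊛_ = _*ₚ_ F

  _≋ₘ_ : Mat F → Mat F → Set ℓ
  _≋ₘ_ = _≈ₘ_ F

  ⟨_,_,_⟩ : Poly F → Poly F → Poly F → Mat F
  ⟨_,_,_⟩ = heis F

  convSum-cong : ∀ {h h' : ℕ → ℕ → Carrier} → (∀ i j → h i j ≈ h' i j) →
                 ∀ m n → convSum F h m n ≈ convSum F h' m n
  convSum-cong e zero    n = e zero n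
  convSum-cong e (suc m) n = +-cong (e (suc m) (n ∸ suc m)) (convSum-cong e m n)

  convSum-vanishes : ∀ (h : ℕ → ℕ → Carrier) m n →
                     (∀ i → i ≤ m → h i (n ∸ i) ≈ 0#) → convSum F h m n ≈ 0#
  convSum-vanishes h zero    n e = e zero z≤n
  convSum-vanishes h (suc m) n e = begin
    h (suc m) (n ∸ suc m) + convSum F h m n
      ≈⟨ +-cong (e (suc m) ≤-refl) (convSum-vanishes h m n (λ i i≤m → e i (m≤n⇒m≤1+n i≤m))) ⟩
    0# + 0#
      ≈⟨ +-identityˡ 0# ⟩
    0# ∎

  ⊛-cong : ∀ {f f' g g'} → f ≋ f' → g ≋ g' → f ⊛ g ≋ f' ⊛ g'
  ⊛-cong ef eg n = convSum-cong (λ i j → *-cong (ef i) (eg j)) n n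

  ⊛-zeroˡ : ∀ f → 0ₚ F ⊛ f ≋ 0ₚ F
  ⊛-zeroˡ f n = convSum-vanishes _ n n (λ i _ → zeroˡ _)

  ⊛-zeroʳ : ∀ f → f ⊛ 0ₚ F ≋ 0ₚ F
  ⊛-zeroʳ f n = convSum-vanishes _ n n (λ i _ → zeroʳ _)

  ⊛-identityˡ : ∀ f → 1ₚ F ⊛ f ≋ f
  ⊛-identityˡ f n = go n
    where
    go : ∀ m → convSum F (λ i j → 1ₚ F i * f j) m n ≈ f n
    go zero    = *-identityˡ (f n)
    go (suc m) = trans (+-cong (zeroˡ _) (go m)) (+-identityˡ (f n))

  ⊛-identityʳ : ∀ f → f ⊛ 1ₚ F ≋ f
  ⊛-identityʳ f zero    = *-identityʳ (f zero)
  ⊛-identityʳ f (suc n) rewrite n∸n≡0 n = begin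
    f (suc n) * 1# + convSum F (λ i j → f i * 1ₚ F j) n (suc n)
      ≈⟨ +-cong (*-identityʳ _) (convSum-vanishes _ n (suc n) lower-terms) ⟩
    f (suc n) + 0#
      ≈⟨ +-identityʳ _ ⟩
    f (suc n) ∎
    where
    1ₚ-positive : ∀ k → 0 < k → 1ₚ F k ≈ 0#
    1ₚ-positive (suc k) _ = refl

    lower-terms : ∀ i → i ≤ n → f i * 1ₚ F (suc n ∸ i) ≈ 0#
    lower-terms i i≤n = trans (*-congˡ (1ₚ-positive _ (m<n⇒0<n∸m (s≤s i≤n)))) (zeroʳ _)

  ⊛-degree-linear : ∀ {f g} → DegLe F f 1 → DegLe F g 1 → DegLe F (f ⊛ g) 2
  ⊛-degree-linear {f} {g} df dg (suc (suc (suc k))) (s≤s (s≤s (s≤s _))) =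
    convSum-vanishes _ _ _ summand
    where
    summand : ∀ i → i ≤ suc (suc (suc k)) → f i * g (suc (suc (suc k)) ∸ i) ≈ 0#
    summand zero          _ = trans (*-congˡ (dg _ (s≤s (s≤s z≤n)))) (zeroʳ _)
    summand (suc zero)    _ = trans (*-congˡ (dg _ (s≤s (s≤s z≤n)))) (zeroʳ _)
    summand (suc (suc i)) _ = trans (*-congʳ (df _ (s≤s (s≤s z≤n)))) (zeroˡ _)

  ⊛-comm-linear : ∀ {f g} → DegLe F f 1 → DegLe F g 1 → f ⊛ g ≋ g ⊛ f
  ⊛-comm-linear {f} {g} df dg zero = *-comm (f 0) (g 0)
  ⊛-comm-linear {f} {g} df dg 1 = begin
    f 1 * g 0 + f 0 * g 1 ≈⟨ +-comm _ _ ⟩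
    f 0 * g 1 + f 1 * g 0 ≈⟨ +-cong (*-comm _ _) (*-comm _ _) ⟩
    g 1 * f 0 + g 0 * f 1 ∎
  ⊛-comm-linear {f} {g} df dg 2 = begin
    f 2 * g 0 + (f 1 * g 1 + f 0 * g 2) ≈⟨ +-cong (*-comm _ _) (+-cong (*-comm _ _) (*-comm _ _)) ⟩
    g 0 * f 2 + (g 1 * f 1 + g 2 * f 0) ≈⟨ +-comm _ _ ⟩
    (g 1 * f 1 + g 2 * f 0) + g 0 * f 2 ≈⟨ +-congʳ (+-comm _ _) ⟩
    (g 2 * f 0 + g 1 * f 1) + g 0 * f 2 ≈⟨ +-assoc _ _ _ ⟩
    g 2 * f 0 + (g 1 * f 1 + g 0 * f 2) ∎
  ⊛-comm-linear {f} {g} df dg n@(suc (suc (suc _))) =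
    trans (⊛-degree-linear df dg n high) (sym (⊛-degree-linear dg df n high))
    where
    high : 2 < n
    high = s≤s (s≤s (s≤s z≤n))

  ·-cong : ∀ {A A' B B'} → A ≋ₘ A' → B ≋ₘ B' → _·_ F A B ≋ₘ _·_ F A' B'
  ·-cong eA eB i j n =
    +-cong (+-cong (⊛-cong (eA i 0F) (eB 0F j) n) (⊛-cong (eA i 1F) (eB 1F j) n))
           (⊛-cong (eA i 2F) (eB 2F j) n)

  ⟨⟩-cong : ∀ {a a' b b' c c'} → a ≋ a' → b ≋ b' → c ≋ c' → ⟨ a , b , c ⟩ ≋ₘ ⟨ a' , b' , c' ⟩
  ⟨⟩-cong ea eb ec 0F 0F = λ _ → refl
  ⟨⟩-cong ea eb ec 0F 1F = ea
  ⟨⟩-cong ea eb ec 0F 2F = eb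
  ⟨⟩-cong ea eb ec 1F 0F = λ _ → refl
  ⟨⟩-cong ea eb ec 1F 1F = λ _ → refl
  ⟨⟩-cong ea eb ec 1F 2F = ec
  ⟨⟩-cong ea eb ec 2F 0F = λ _ → refl
  ⟨⟩-cong ea eb ec 2F 1F = λ _ → refl
  ⟨⟩-cong ea eb ec 2F 2F = λ _ → refl

  only-first : ∀ x → x + 0# + 0# ≈ x
  only-first x = trans (+-identityʳ _) (+-identityʳ x)

  only-second : ∀ x → 0# + x + 0# ≈ x
  only-second x = trans (+-identityʳ _) (+-identityˡ x)

  -- The Heisenberg multiplication law.  Every entry of the product is a sum
  -- of three Cauchy products with a constant 0 or 1 in all but one factor.
  heis-mul : ∀ a b c a' b' c' →
             _·_ F ⟨ a , b , c ⟩ ⟨ a' , b' , c' ⟩ ≋ₘ ⟨ a ⊕ a' , (b ⊕ b') ⊕ a ⊛ c' , c ⊕ c' ⟩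
  heis-mul a b c a' b' c' 0F 0F n =
    trans (+-cong (+-cong (⊛-identityˡ _ n) (⊛-zeroʳ a n)) (⊛-zeroʳ b n)) (only-first _)
  heis-mul a b c a' b' c' 0F 1F n = begin
    (1ₚ F ⊛ a') n + (a ⊛ 1ₚ F) n + (b ⊛ 0ₚ F) n
      ≈⟨ +-cong (+-cong (⊛-identityˡ a' n) (⊛-identityʳ a n)) (⊛-zeroʳ b n) ⟩
    a' n + a n + 0#  ≈⟨ +-identityʳ _ ⟩
    a' n + a n       ≈⟨ +-comm _ _ ⟩
    a n + a' n       ∎
  heis-mul a b c a' b' c' 0F 2F n = begin
    (1ₚ F ⊛ b') n + (a ⊛ c') n + (b ⊛ 1ₚ F) n
      ≈⟨ +-congˡ (⊛-identityʳ b n) ⟩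
    (1ₚ F ⊛ b') n + (a ⊛ c') n + b n
      ≈⟨ +-congʳ (+-congʳ (⊛-identityˡ b' n)) ⟩
    b' n + (a ⊛ c') n + b n  ≈⟨ +-assoc _ _ _ ⟩
    b' n + ((a ⊛ c') n + b n) ≈⟨ +-congˡ (+-comm _ _) ⟩
    b' n + (b n + (a ⊛ c') n) ≈⟨ sym (+-assoc _ _ _) ⟩
    b' n + b n + (a ⊛ c') n  ≈⟨ +-congʳ (+-comm _ _) ⟩
    b n + b' n + (a ⊛ c') n  ∎
  heis-mul a b c a' b' c' 1F 0F n =
    trans (+-cong (+-cong (⊛-zeroˡ _ n) (⊛-identityˡ _ n)) (⊛-zeroʳ c n)) (only-first _)
  heis-mul a b c a' b' c' 1F 1F n =
    trans (+-cong (+-cong (⊛-zeroˡ a' n) (⊛-identityˡ _ n)) (⊛-zeroʳ c n)) (only-second _)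
  heis-mul a b c a' b' c' 1F 2F n = begin
    (0ₚ F ⊛ b') n + (1ₚ F ⊛ c') n + (c ⊛ 1ₚ F) n
      ≈⟨ +-cong (+-cong (⊛-zeroˡ b' n) (⊛-identityˡ c' n)) (⊛-identityʳ c n) ⟩
    0# + c' n + c n  ≈⟨ +-congʳ (+-identityˡ _) ⟩
    c' n + c n       ≈⟨ +-comm _ _ ⟩
    c n + c' n       ∎
  heis-mul a b c a' b' c' 2F 0F n =
    trans (+-cong (+-cong (⊛-zeroˡ _ n) (⊛-zeroˡ _ n)) (⊛-identityˡ _ n)) (only-first _)
  heis-mul a b c a' b' c' 2F 1F n =
    trans (+-cong (+-cong (⊛-zeroˡ a' n) (⊛-zeroˡ _ n)) (⊛-identityˡ _ n)) (only-first _)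
  heis-mul a b c a' b' c' 2F 2F n =
    trans (+-cong (+-cong (⊛-zeroˡ b' n) (⊛-zeroˡ c' n)) (⊛-identityˡ _ n)) only-third
    where
    only-third : 0# + 0# + 1ₚ F n ≈ 1ₚ F n
    only-third = trans (+-congʳ (+-identityˡ 0#)) (+-identityˡ _)

  ≋ₘ-refl : ∀ {A} → A ≋ₘ A
  ≋ₘ-refl i j n = refl

  ≋ₘ-sym : ∀ {A B} → A ≋ₘ B → B ≋ₘ A
  ≋ₘ-sym e i j n = sym (e i j n)

  ≋ₘ-trans : ∀ {A B C} → A ≋ₘ B → B ≋ₘ C → A ≋ₘ C
  ≋ₘ-trans e e' i j n = trans (e i j n) (e' i j n)

  coset₁ : ∀ l Q a → _·_ F (M₁ F l Q) ⟨ a , 0ₚ F , 0ₚ F ⟩ ≋ₘ ⟨ a , Q , l ⟩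
  coset₁ l Q a = ≋ₘ-trans (heis-mul (0ₚ F) Q l a (0ₚ F) (0ₚ F))
    (⟨⟩-cong (λ n → +-identityˡ (a n))
             (λ n → trans (+-cong (+-identityʳ (Q n)) (⊛-zeroˡ (0ₚ F) n)) (+-identityʳ (Q n)))
             (λ n → +-identityʳ (l n)))

  coset₂ : ∀ l Q c → _·_ F (M₂ F l Q) ⟨ 0ₚ F , 0ₚ F , c ⟩ ≋ₘ ⟨ l , Q ⊕ l ⊛ c , c ⟩
  coset₂ l Q c = ≋ₘ-trans (heis-mul l Q (0ₚ F) (0ₚ F) (0ₚ F) c)
    (⟨⟩-cong (λ n → +-identityʳ (l n))
             (λ n → +-congʳ (+-identityʳ (Q n)))
             (λ n → +-identityˡ (c n)))

  coset₁-element : ∀ l Q a {h} → h ≋ₘ ⟨ a , 0ₚ F , 0ₚ F ⟩ → _·_ F (M₁ F l Q) h ≋ₘ ⟨ a , Q , l ⟩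
  coset₁-element l Q a h≋ = ≋ₘ-trans (·-cong {A = M₁ F l Q} ≋ₘ-refl h≋) (coset₁ l Q a)

  coset₂-element : ∀ l Q c {h} → h ≋ₘ ⟨ 0ₚ F , 0ₚ F , c ⟩ → _·_ F (M₂ F l Q) h ≋ₘ ⟨ l , Q ⊕ l ⊛ c , c ⟩
  coset₂-element l Q c h≋ = ≋ₘ-trans (·-cong {A = M₂ F l Q} ≋ₘ-refl h≋) (coset₂ l Q c)

  -- A common point ⟨a, Q₁, l₁⟩ = ⟨l₂, Q₂ + l₂ c, c⟩ of the two cosets forces
  -- c = l₁, hence Q₁ = Q₂ + l₂ l₁.
  cosets-meet⇒ : ∀ {l₁ l₂ Q₁ Q₂} → CosetsMeet F (M₁ F l₁ Q₁) (M₂ F l₂ Q₂) → Q₁ ≋ Q₂ ⊕ l₂ ⊛ l₁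
  cosets-meet⇒ {l₁} {l₂} {Q₁} {Q₂} (h₁ , h₂ , (a , _ , h₁≋) , (c , _ , h₂≋) , meet) n =
    trans (common 0F 2F n) (+-congˡ (⊛-cong (λ _ → refl) (λ m → sym (common 1F 2F m)) n))
    where
    common : ⟨ a , Q₁ , l₁ ⟩ ≋ₘ ⟨ l₂ , Q₂ ⊕ l₂ ⊛ c , c ⟩
    common = ≋ₘ-trans (≋ₘ-sym (coset₁-element l₁ Q₁ a h₁≋))
                      (≋ₘ-trans meet (coset₂-element l₂ Q₂ c h₂≋))

  -- Conversely, if Q₁ = Q₂ + l₂ l₁ then ⟨l₂, Q₁, l₁⟩ lies in both cosets.
  cosets-meet⇐ : ∀ {l₁ l₂ Q₁ Q₂} → DegLe F l₁ 1 → DegLe F l₂ 1 →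
                 Q₁ ≋ Q₂ ⊕ l₂ ⊛ l₁ → CosetsMeet F (M₁ F l₁ Q₁) (M₂ F l₂ Q₂)
  cosets-meet⇐ {l₁} {l₂} {Q₁} {Q₂} dl₁ dl₂ eq =
    ⟨ l₂ , 0ₚ F , 0ₚ F ⟩ , ⟨ 0ₚ F , 0ₚ F , l₁ ⟩ ,
    (l₂ , dl₂ , ≋ₘ-refl) , (l₁ , dl₁ , ≋ₘ-refl) ,
    ≋ₘ-trans (coset₁ l₁ Q₁ l₂)
      (≋ₘ-trans (⟨⟩-cong (λ _ → refl) eq (λ _ → refl)) (≋ₘ-sym (coset₂ l₂ Q₂ l₁)))

  sum⇒difference : ∀ {P Q₁ Q₂} → Q₁ ≋ Q₂ ⊕ P → P ≋ _-ₚ_ F Q₁ Q₂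
  sum⇒difference {P} {Q₁} {Q₂} eq n = x≈z//y (P n) (Q₂ n) (Q₁ n) (trans (+-comm _ _) (sym (eq n)))

  difference⇒sum : ∀ {P Q₁ Q₂} → P ≋ _-ₚ_ F Q₁ Q₂ → Q₁ ≋ Q₂ ⊕ P
  difference⇒sum {P} {Q₁} {Q₂} eq n = begin
    Q₁ n             ≈⟨ sym (//-rightDividesˡ (Q₂ n) (Q₁ n)) ⟩
    Q₁ n - Q₂ n + Q₂ n ≈⟨ +-congʳ (sym (eq n)) ⟩
    P n + Q₂ n       ≈⟨ +-comm _ _ ⟩
    Q₂ n + P n       ∎

mainTheorem8 : {c ℓ : Level} (F : CommutativeRing c ℓ) → IsField F → (p : ℕ) → IsPrimePower p → HasCard F p →
    (l₁ l₂ Q₁ Q₂ : Poly F) → DegLe F l₁ 1 → DegLe F l₂ 1 → DegLe F Q₁ 2 → DegLe F Q₂ 2 →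
    (CosetsMeet F (M₁ F l₁ Q₁) (M₂ F l₂ Q₂) → _≈ₚ_ F (_*ₚ_ F l₁ l₂) (_-ₚ_ F Q₁ Q₂))
    × (_≈ₚ_ F (_*ₚ_ F l₁ l₂) (_-ₚ_ F Q₁ Q₂) → CosetsMeet F (M₁ F l₁ Q₁) (M₂ F l₂ Q₂))
mainTheorem8 F _ _ _ _ l₁ l₂ Q₁ Q₂ dl₁ dl₂ _ _ = meet⇒criterion , criterion⇒meet
  where
  open HeisenbergCosets F
  open CommutativeRing F using (trans; +-congˡ)

  swap : ∀ {Q} → Q ≋ Q₂ ⊕ l₂ ⊛ l₁ → Q ≋ Q₂ ⊕ l₁ ⊛ l₂
  swap eq n = trans (eq n) (+-congˡ (⊛-comm-linear dl₂ dl₁ n))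

  meet⇒criterion : CosetsMeet F (M₁ F l₁ Q₁) (M₂ F l₂ Q₂) → l₁ ⊛ l₂ ≋ _-ₚ_ F Q₁ Q₂
  meet⇒criterion meet = sum⇒difference (swap (cosets-meet⇒ meet))

  criterion⇒meet : l₁ ⊛ l₂ ≋ _-ₚ_ F Q₁ Q₂ → CosetsMeet F (M₁ F l₁ Q₁) (M₂ F l₂ Q₂)
  criterion⇒meet eq = cosets-meet⇐ dl₁ dl₂
    (λ n → trans (difference⇒sum eq n) (+-congˡ (⊛-comm-linear dl₁ dl₂ n)))
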